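{- Let $\omega\in S_n$, let $i,j\in[n]$ with $c_i(\omega),c_j(\omega)>0$, $p\in[c_i(\omega)]$ and $q\in[c_j(\omega)]$. If $m_{i,p}(\omega)>m_{j,q}(\omega)$, then $c_j(\omega)\ge c_i(\omega)+q-p$.
   Context: Permutations are in one-line notation. ${\rm Inv}(\omega)=\{(i,j): 1\le i<j\le n,\ \omega(i)>\omega(j)\}$; $c_i(\omega)=\#\{j>i: \omega(i)>\omega(j)\}$; for $i<j$, $c_{i,j}(\omega)=\#\{k: i<k<j,\ \omega(i)>\omega(k)\}$; $[m]=\{1,\dots,m\}$. For $c_i(\omega)>0$ and $x\in[c_i(\omega)]$, $m_{i,x}(\omega)\in\mathbb{N}^n$ has $j$-th coordinate: $0$ if $(i,j)\in{\rm Inv}(\omega)$; $0$ if $j<i$; $x$ if $j=i$; $\max\{0,x-c_{i,j}(\omega)\}$ if $j>i$ and $(i,j)\notin{\rm Inv}(\omega)$. The order $>$ is the strict componentwise order on $\mathbb{N}^n$. -}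

module Defs where

open import Data.Nat using (ℕ; _∸_)
open import Data.Fin using (Fin; _<_; _>_; _<?_)
open import Data.Fin.Permutation using (Permutation′; _⟨$⟩ʳ_)
open import Data.List using (length; filter)
open import Data.List.Base using (allFin)
open import Data.Product using (_×_)
open import Relation.Nullary using (Dec; yes; no; ¬_)
open import Relation.Nullary.Decidable using (_×-dec_)
open import Relation.Binary.PropositionalEquality using (_≡_)
open import Data.Fin using (_≟_)
import Data.Nat as ℕ

-- Permutations of [n] are represented as Permutation′ n (bijections Fin n → Fin n),
-- positions 1..n are Fin n (0-based internally), ω(i) is  ω ⟨$⟩ʳ i .

c : ∀ {n} → Permutation′ n → Fin n → ℕ
c {n} ω i = length (filter (λ j → (i <? j) ×-dec ((ω ⟨$⟩ʳ j) <? (ω ⟨$⟩ʳ i))) (allFin n))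

cc : ∀ {n} → Permutation′ n → Fin n → Fin n → ℕ
cc {n} ω i j = length (filter (λ k → ((i <? k) ×-dec (k <? j)) ×-dec ((ω ⟨$⟩ʳ k) <? (ω ⟨$⟩ʳ i))) (allFin n))

m : ∀ {n} → Permutation′ n → Fin n → ℕ → (Fin n → ℕ)
m ω i x j with j <? i
... | yes _ = 0
... | no _ with j ≟ i
...   | yes _ = x
...   | no _ with (ω ⟨$⟩ʳ j) <? (ω ⟨$⟩ʳ i)
...     | yes _ = 0
...     | no _ = x ∸ cc ω i j

_>ᶜ_ : ∀ {n} → (Fin n → ℕ) → (Fin n → ℕ) → Set
_>ᶜ_ {n} a b = ((k : Fin n) → b k ℕ.≤ a k) × ¬ ((k : Fin n) → a k ≡ b k)

-- Only q ≥ 1 and the j-th coordinate of m_{i,p} > m_{j,q} are needed: they say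
-- 0 < q ≤ m_{i,p}(j). If i = j this is q ≤ p. Otherwise (i, j) is a non-inversion
-- with i < j and q ≤ p − c_{i,j}. Every k counted by c_i either lies strictly between
-- i and j (counted by c_{i,j}) or lies beyond j, where ω(k) < ω(i) < ω(j) makes it
-- counted by c_j; hence c_i ≤ c_{i,j} + c_j, and adding q + c_{i,j} ≤ p gives the claim.
module Submission where

open import Defs
open import Data.Nat using (ℕ; _≤_; _+_)
open import Data.Fin using (Fin)
open import Data.Fin.Permutation using (Permutation′)

open import Data.Nat using (_<_; _∸_; z≤n; s≤s)
open import Data.Nat.Properties
  using ( ≤-refl; ≤-trans; <-≤-trans; ≤-reflexive; <⇒≤; n≤1+n; <-irrefl; <-asym; <-trans
        ; ≮⇒≥; +-mono-≤; +-monoˡ-≤; +-monoʳ-≤; +-suc; +-comm; +-assoc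
        ; m<n⇒n≢0; m∸n≢0⇒n<m; m≤o∸n⇒m+n≤o; module ≤-Reasoning )
import Data.Fin as Fin
import Data.Fin.Properties as Fin
open import Data.Fin.Permutation using (_⟨$⟩ʳ_)
open import Data.List using (List; []; _∷_; length; filter)
open import Data.List.Base using (allFin)
open import Data.Product using (_×_; _,_)
open import Data.Sum using (_⊎_; inj₁; inj₂)
open import Data.Empty using (⊥-elim)
open import Function.Bundles using (Injection)
open import Function.Properties.Inverse using (↔⇒↣)
open import Level using (Level)
open import Relation.Nullary using (yes; no)
open import Relation.Unary using (Pred; Decidable; _⊆_; _∪_)
open import Relation.Binary.PropositionalEquality using (_≡_; refl; sym; cong; subst)

private
  variable
    a ℓ : Level
    A : Set a

length-filter-≤-∷ : {P : Pred A ℓ} (P? : Decidable P) (x : A) (xs : List A) →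
  length (filter P? xs) ≤ length (filter P? (x ∷ xs))
length-filter-≤-∷ P? x xs with P? x
... | yes _ = n≤1+n _
... | no _  = ≤-refl

length-filter-⊆-∪ : {P Q R : Pred A ℓ} (P? : Decidable P) (Q? : Decidable Q) (R? : Decidable R) →
  P ⊆ Q ∪ R → (xs : List A) →
  length (filter P? xs) ≤ length (filter Q? xs) + length (filter R? xs)
length-filter-⊆-∪ P? Q? R? P⊆Q∪R []       = z≤n
length-filter-⊆-∪ P? Q? R? P⊆Q∪R (x ∷ xs) with ih ← length-filter-⊆-∪ P? Q? R? P⊆Q∪R xs | P? x
... | no _ = ≤-trans ih (+-mono-≤ (length-filter-≤-∷ Q? x xs) (length-filter-≤-∷ R? x xs))
... | yes px with Q? x
...   | yes _ = s≤s (≤-trans ih (+-monoʳ-≤ _ (length-filter-≤-∷ R? x xs)))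
...   | no ¬q with R? x
...     | yes _ = ≤-trans (s≤s ih) (≤-reflexive (sym (+-suc _ _)))
...     | no ¬r with P⊆Q∪R px
...       | inj₁ q = ⊥-elim (¬q q)
...       | inj₂ r = ⊥-elim (¬r r)

≤+⇒+≤+ : ∀ {a b p q x} → a ≤ x + b → q + x ≤ p → a + q ≤ b + p
≤+⇒+≤+ {a} {b} {p} {q} {x} a≤x+b q+x≤p = begin
  a + q       ≤⟨ +-monoˡ-≤ q a≤x+b ⟩
  x + b + q   ≡⟨ cong (_+ q) (+-comm x b) ⟩
  b + x + q   ≡⟨ +-assoc b x q ⟩
  b + (x + q) ≡⟨ cong (b +_) (+-comm x q) ⟩
  b + (q + x) ≤⟨ +-monoʳ-≤ b q+x≤p ⟩
  b + p       ∎
  where open ≤-Reasoning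

0<m≤n∸o⇒m+o≤n : ∀ {m n o} → 0 < m → m ≤ n ∸ o → m + o ≤ n
0<m≤n∸o⇒m+o≤n 0<m m≤n∸o = m≤o∸n⇒m+n≤o _ (<⇒≤ (m∸n≢0⇒n<m (m<n⇒n≢0 (<-≤-trans 0<m m≤n∸o)))) m≤n∸o

module _ {n : ℕ} (ω : Permutation′ n) where

  c≤cc+c : ∀ {i j} → i Fin.< j → ω ⟨$⟩ʳ i Fin.< ω ⟨$⟩ʳ j → c ω i ≤ cc ω i j + c ω j
  c≤cc+c {i} {j} i<j ωi<ωj = length-filter-⊆-∪ _ _ _ split (allFin n)
    where
    split : ∀ {k} → i Fin.< k × ω ⟨$⟩ʳ k Fin.< ω ⟨$⟩ʳ i →
            ((i Fin.< k × k Fin.< j) × ω ⟨$⟩ʳ k Fin.< ω ⟨$⟩ʳ i) ⊎ (j Fin.< k × ω ⟨$⟩ʳ k Fin.< ω ⟨$⟩ʳ j)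
    split {k} (i<k , ωk<ωi) with k Fin.<? j | k Fin.≟ j
    ... | yes k<j | _        = inj₁ ((i<k , k<j) , ωk<ωi)
    ... | no _    | yes refl = ⊥-elim (<-asym ωk<ωi ωi<ωj)
    ... | no k≮j  | no k≢j   = inj₂ (Fin.≤∧≢⇒< (≮⇒≥ k≮j) (λ j≡k → k≢j (sym j≡k)) , <-trans ωk<ωi ωi<ωj)

  m-diagonal : ∀ i x → m ω i x i ≡ x
  m-diagonal i x with i Fin.<? i
  ... | yes i<i = ⊥-elim (<-irrefl refl i<i)
  ... | no _ with i Fin.≟ i
  ...   | yes _   = refl
  ...   | no i≢i  = ⊥-elim (i≢i refl)

  0<m⇒diagonal⊎non-inversion : ∀ i j x → 0 < m ω i x j →
    i ≡ j ⊎ (i Fin.< j × ω ⟨$⟩ʳ i Fin.< ω ⟨$⟩ʳ j × m ω i x j ≡ x ∸ cc ω i j)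
  0<m⇒diagonal⊎non-inversion i j x 0<mᵢₓⱼ with j Fin.<? i
  ... | yes _ = ⊥-elim (<-irrefl refl 0<mᵢₓⱼ)
  ... | no j≮i with j Fin.≟ i
  ...   | yes refl = inj₁ refl
  ...   | no j≢i with ω ⟨$⟩ʳ j Fin.<? ω ⟨$⟩ʳ i
  ...     | yes _    = ⊥-elim (<-irrefl refl 0<mᵢₓⱼ)
  ...     | no ωj≮ωi = inj₂ ( Fin.≤∧≢⇒< (≮⇒≥ j≮i) (λ i≡j → j≢i (sym i≡j))
                            , Fin.≤∧≢⇒< (≮⇒≥ ωj≮ωi) (λ ωi≡ωj → j≢i (Injection.injective (↔⇒↣ ω) (sym ωi≡ωj)))
                            , refl )

  0<q≤m⇒c+q≤c+p : ∀ {i j p q} → 0 < q → q ≤ m ω i p j → c ω i + q ≤ c ω j + p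
  0<q≤m⇒c+q≤c+p {i} {j} {p} {q} 0<q q≤mᵢₚⱼ
    with 0<m⇒diagonal⊎non-inversion i j p (<-≤-trans 0<q q≤mᵢₚⱼ)
  ... | inj₁ refl = +-monoʳ-≤ (c ω i) (subst (q ≤_) (m-diagonal i p) q≤mᵢₚⱼ)
  ... | inj₂ (i<j , ωi<ωj , mᵢₚⱼ≡p∸cc) =
    ≤+⇒+≤+ {x = cc ω i j} (c≤cc+c i<j ωi<ωj) (0<m≤n∸o⇒m+o≤n 0<q (subst (q ≤_) mᵢₚⱼ≡p∸cc q≤mᵢₚⱼ))

mainTheorem5 : (n : ℕ) (ω : Permutation′ n) (i j : Fin n) (p q : ℕ) →
    1 ≤ p → p ≤ c ω i → 1 ≤ q → q ≤ c ω j →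
    m ω i p >ᶜ m ω j q →
    c ω i + q ≤ c ω j + p
mainTheorem5 n ω i j p q _ _ 0<q _ (mⱼq≤mᵢₚ , _) =
  0<q≤m⇒c+q≤c+p ω 0<q (subst (_≤ m ω i p j) (m-diagonal ω j q) (mⱼq≤mᵢₚ j))
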